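{- Let $p$ be a prime and let $A,B$ be two sequences of $p$ nonzero elements of $\mathbb{F}_p$. Then $\mathcal{S}_A=\mathcal{S}_B$ if and only if $A$ and $B$ are collinear as vectors of $\mathbb{F}_p^p$.
   Context: For a sequence $C=(c_1,\dots,c_\ell)$ of elements of $\mathbb{F}_p$, $\mathcal{S}_C=\{x\in\{0,1\}^\ell : c_1x_1+\dots+c_\ell x_\ell=0 \text{ in } \mathbb{F}_p\}$. -}

module Defs where

open import Data.Nat using (ℕ; _*_; _+_)
open import Data.Nat.DivMod using (_mod_)
open import Data.Nat.Divisibility using (_∣_)
open import Data.Nat.Primality using (Prime; prime⇒nonZero)
open import Data.Fin using (Fin; toℕ)
open import Data.Bool using (Bool; true; false)
open import Data.Vec using (tabulate)
open import Data.Vec using () renaming (sum to vsum)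
open import Data.Product using (∃; Σ)
open import Data.Sum using (_⊎_)
open import Relation.Binary.PropositionalEquality using (_≡_)

-- Elements of 𝔽_p are represented by Fin p (residues 0 … p-1).
-- A sequence of length ℓ over 𝔽_p is a function Fin ℓ → Fin p;
-- a point of {0,1}^ℓ is a function Fin ℓ → Bool (true = 1, false = 0).

bit : Bool → ℕ
bit true  = 1
bit false = 0

-- x ∈ 𝒮_C  iff  c₁x₁ + … + c_ℓx_ℓ = 0 in 𝔽_p, i.e. p divides the integer sum.
InS : (p : ℕ) {ℓ : ℕ} → (Fin ℓ → Fin p) → (Fin ℓ → Bool) → Set
InS p {ℓ} c x = p ∣ vsum (tabulate {n = ℓ} (λ i → toℕ (c i) * bit (x i)))

SameS : (p : ℕ) {ℓ : ℕ} → (Fin ℓ → Fin p) → (Fin ℓ → Fin p) → Set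
SameS p {ℓ} a b = ∀ (x : Fin ℓ → Bool) → (InS p a x → InS p b x) Data.Product.× (InS p b x → InS p a x)
  where import Data.Product

scale : (p : ℕ) → Prime p → {ℓ : ℕ} → Fin p → (Fin ℓ → Fin p) → Fin ℓ → Fin p
scale p pr λ' a i = (toℕ λ' * toℕ (a i) mod p) {{prime⇒nonZero pr}}

Collinear : (p : ℕ) → Prime p → {ℓ : ℕ} → (Fin ℓ → Fin p) → (Fin ℓ → Fin p) → Set
Collinear p pr a b =
  (∃ λ (μ : Fin p) → ∀ i → b i ≡ scale p pr μ a i) ⊎
  (∃ λ (μ : Fin p) → ∀ i → a i ≡ scale p pr μ b i)

module Submission where

-- If B = μA with μ ≢ 0, then B·x ≡ μ (A·x) and 𝒮_A = 𝒮_B is immediate.  The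
-- converse is the polynomial method.  Let f (y) = (y - 1)(y - 2)⋯(y - (p - 1)).
-- Modulo p, f y only depends on whether p ∣ y, since it vanishes at every
-- non-multiple; so 𝒮_A = 𝒮_B gives f (A·x) ≡ f (B·x) for all x ∈ {0,1}^p.  The
-- iterated difference of f along the p - 1 steps a_i (i ≠ k) is a signed sum of
-- values f (A·x), and as f is monic of degree p - 1 it equals (p - 1)! ∏_{i≠k} a_i.
-- Comparing with B and cancelling (p - 1)! yields ∏_{i≠k} a_i ≡ ∏_{i≠k} b_i for
-- every k, hence b_k ∏ a ≡ a_k ∏ b, i.e. B ≡ μA with μ = ∏ b / ∏ a.

open import Defs
open import Data.Nat as ℕ using (ℕ; zero; suc; _!)
import Data.Nat.Properties as ℕ
open import Data.Nat.Divisibility using (>⇒∤) renaming (_∣_ to _∣ℕ_)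
open import Data.Nat.Primality using (Prime; euclidsLemma; prime⇒nonTrivial; ¬prime[0])
open import Data.Nat.Coprimality using (coprime-Bézout; prime⇒coprime)
open import Data.Nat.GCD using (module Bézout)
open import Data.Integer as ℤ using (ℤ; +_; 0ℤ; 1ℤ; _+_; _*_; _-_; -_; _%ℕ_; _/ℕ_)
open import Data.Integer.Tactic.RingSolver using (solve-∀)
open import Data.Integer.Properties
  using (pos-*; pos-+; +-inverseʳ; *-zeroʳ; *-identityˡ; abs-*; +-injective; i-j≡0⇒i≡j; ∣i∣≡0⇒i≡0; [+m]-[+n]≡m⊖n; ∣m⊝n∣≤m⊔n)
open import Data.Integer.DivMod using (a≡a%ℕn+[a/ℕn]*n; n%ℕd<d)
open import Data.Nat.DivMod using (m%n<n)
open import Data.Integer.Divisibility.Signed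
  using (_∣_; _∣?_; divides; ∣ᵤ⇒∣; ∣⇒∣ᵤ; ∣m∣n⇒∣m+n; ∣m∣n⇒∣m-n; ∣m⇒∣-m; ∣n⇒∣m*n; ∣m⇒∣m*n)
open import Data.Product as Product using (∃; _,_; _×_; proj₁; proj₂)
open import Data.Sum as Sum using (_⊎_; inj₁; inj₂)
open import Function using (_∘_; id; flip; _⇔_; Equivalence; mk⇔)
open import Relation.Nullary using (¬_; yes; no; contradiction)
open import Data.Fin using (Fin; zero; suc; toℕ; fromℕ<)
open import Data.Fin.Properties using (toℕ<n; toℕ-fromℕ<; toℕ-injective)
open import Data.Fin.Subset using (Subset; inside; outside; ⊤; ⊥; ⁅_⁆; ∁) renaming (∣_∣ to card)
open import Data.Fin.Subset.Properties using (∣p∣≡n⇒p≡⊤; ∣∁p∣≡n∸∣p∣; ∣⊥∣≡0; ∣⁅x⁆∣≡1)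
open import Data.Bool using (Bool; true; false)
open import Data.Vec using (_∷_; []; lookup; tabulate) renaming (sum to vsum)
open import Data.Vec.Properties using (tabulate∘lookup)
open import Relation.Binary.Bundles using (Setoid)
import Relation.Binary.Reasoning.Setoid as ≈-Reasoning
open import Relation.Binary.PropositionalEquality
open Equivalence using (to; from)

Δ : ℤ → (ℤ → ℤ) → ℤ → ℤ
Δ a f y = f (a + y) - f y

-- Leading n L f: f is a polynomial function of degree at most n with
-- coefficient L at yⁿ, characterised through differences only: f is the
-- constant L when n = 0, and every Δ a f is Leading (n - 1) (n·L·a).
data Leading : ℕ → ℤ → (ℤ → ℤ) → Set where
  constant    : ∀ {L f} → (∀ y → f y ≡ L) → Leading zero L f
  differences : ∀ {n L f} → (∀ a → Leading n (+ suc n * L * a) (Δ a f)) →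
                Leading (suc n) L f

Leading-ext : ∀ {n L f g} → (∀ y → f y ≡ g y) → Leading n L f → Leading n L g
Leading-ext f≡g (constant hf)    = constant (λ y → trans (sym (f≡g y)) (hf y))
Leading-ext f≡g (differences hf) =
  differences (λ a → Leading-ext (λ y → cong₂ _-_ (f≡g (a + _)) (f≡g y)) (hf a))

Leading-coeff : ∀ {n L M f} → L ≡ M → Leading n L f → Leading n M f
Leading-coeff refl hf = hf

Leading-+ : ∀ {n L M f g} → Leading n L f → Leading n M g →
            Leading n (L + M) (λ y → f y + g y)
Leading-+ (constant hf)    (constant hg)    = constant (λ y → cong₂ _+_ (hf y) (hg y))
Leading-+ {suc n} {L} {M} {f} {g} (differences hf) (differences hg) =
  differences λ a →
    Leading-coeff (coeff (+ suc n) L M a)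
      (Leading-ext (λ y → Δ-+ (f (a + y)) (f y) (g (a + y)) (g y))
        (Leading-+ (hf a) (hg a)))
  where
  coeff : ∀ k L M a → k * L * a + k * M * a ≡ k * (L + M) * a
  coeff = solve-∀
  Δ-+ : ∀ u v w z → (u - v) + (w - z) ≡ (u + w) - (v + z)
  Δ-+ = solve-∀

Leading-scale : ∀ {n L f} u → Leading n L f → Leading n (u * L) (λ y → u * f y)
Leading-scale u (constant hf) = constant (λ y → cong (u *_) (hf y))
Leading-scale {suc n} {L} {f} u (differences hf) =
  differences λ a →
    Leading-coeff (coeff (+ suc n) u L a)
      (Leading-ext (λ y → Δ-scale u (f (a + y)) (f y)) (Leading-scale u (hf a)))
  where
  coeff : ∀ k u L a → u * (k * L * a) ≡ k * (u * L) * a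
  coeff = solve-∀
  Δ-scale : ∀ u v w → u * (v - w) ≡ u * v - u * w
  Δ-scale = solve-∀

Leading-shift : ∀ {n L f} c → Leading n L f → Leading n L (λ y → f (c + y))
Leading-shift c (constant hf) = constant (λ y → hf (c + y))
Leading-shift {f = f} c (differences hf) =
  differences λ a →
    Leading-ext (λ y → cong (λ t → f t - f (c + y)) (swap a c y)) (Leading-shift c (hf a))
  where
  swap : ∀ a c y → a + (c + y) ≡ c + (a + y)
  swap = solve-∀

-- Multiplying by a monic linear factor raises the degree and keeps the
-- leading coefficient, by the product rule
--   Δ a ((y + c)·g) y = (y + c)·Δ a g y + a·g (a + y).
Leading-linearFactor : ∀ {n L g} c → Leading n L g → Leading (suc n) L (λ y → (y + c) * g y)
Leading-linearFactor {L = L} {g} c (constant hg) =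
  differences λ a → constant λ y →
    begin
      (a + y + c) * g (a + y) - (y + c) * g y
        ≡⟨ cong₂ (λ u v → (a + y + c) * u - (y + c) * v) (hg (a + y)) (hg y) ⟩
      (a + y + c) * L - (y + c) * L
        ≡⟨ difference a y c L ⟩
      + 1 * L * a
    ∎
  where
  open ≡-Reasoning
  difference : ∀ a y c L → (a + y + c) * L - (y + c) * L ≡ + 1 * L * a
  difference = solve-∀
Leading-linearFactor {suc n} {L} {g} c hg@(differences hΔg) =
  differences λ a →
    Leading-coeff (coeff (+ suc n) L a)
      (Leading-ext (λ y → productRule a y c (g (a + y)) (g y))
        (Leading-+ (Leading-linearFactor c (hΔg a))
                   (Leading-scale a (Leading-shift a hg))))
  where
  coeff : ∀ k L a → k * L * a + a * L ≡ (1ℤ + k) * L * a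
  coeff = solve-∀
  productRule : ∀ a y c u v → (y + c) * (u - v) + a * u ≡ (a + y + c) * u - (y + c) * v
  productRule = solve-∀

falling : ℕ → ℤ → ℤ
falling zero    y = 1ℤ
falling (suc n) y = (y + - + suc n) * falling n y

falling-leading : ∀ n → Leading n 1ℤ (falling n)
falling-leading zero    = constant (λ y → refl)
falling-leading (suc n) = Leading-linearFactor (- + suc n) (falling-leading n)

falling-root : ∀ n {r} → 1 ℕ.≤ r → r ℕ.≤ n → falling n (+ r) ≡ 0ℤ
falling-root zero    1≤r r≤0 = contradiction r≤0 (ℕ.<⇒≱ 1≤r)
falling-root (suc n) {r} 1≤r r≤1+n with r ℕ.≟ suc n
... | yes refl   = cong (_* falling n (+ r)) (+-inverseʳ (+ r))
... | no  r≢1+n  = trans (cong ((+ r - + suc n) *_) (falling-root n 1≤r r≤n)) (*-zeroʳ (+ r - + suc n))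
  where
  r≤n : r ℕ.≤ n
  r≤n = ℕ.≤-pred (ℕ.≤∧≢⇒< r≤1+n r≢1+n)

subsetSum : ∀ {n} → (Fin n → ℤ) → Subset n → ℤ
subsetSum a []            = 0ℤ
subsetSum a (inside  ∷ x) = a zero + subsetSum (a ∘ suc) x
subsetSum a (outside ∷ x) = subsetSum (a ∘ suc) x

linearForm : ∀ {n} (c : Fin n → ℕ) (x : Fin n → Bool) →
             + vsum (tabulate (λ i → c i ℕ.* bit (x i))) ≡ subsetSum (+_ ∘ c) (tabulate x)
linearForm {zero}  c x = refl
linearForm {suc n} c x with x zero
... | true  = trans (pos-+ (c zero ℕ.* 1) _)
                    (cong₂ _+_ (cong +_ (ℕ.*-identityʳ (c zero))) (linearForm (c ∘ suc) (x ∘ suc)))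
... | false = trans (cong (λ t → + (t ℕ.+ rest)) (ℕ.*-zeroʳ (c zero))) (linearForm (c ∘ suc) (x ∘ suc))
  where
  rest : ℕ
  rest = vsum (tabulate (λ i → c (suc i) ℕ.* bit (x (suc i))))

subsetProduct : ∀ {n} → (Fin n → ℤ) → Subset n → ℤ
subsetProduct a []            = 1ℤ
subsetProduct a (inside  ∷ T) = a zero * subsetProduct (a ∘ suc) T
subsetProduct a (outside ∷ T) = subsetProduct (a ∘ suc) T

-- The iterated difference (∏_{i ∈ T} Δ (a i)) f, evaluated at 0.
-- Expanded, it is a signed sum of the values f (subsetSum a x) for x ⊆ T.
Δ-along : ∀ {n} → (Fin n → ℤ) → Subset n → (ℤ → ℤ) → ℤ
Δ-along a []            f = f 0ℤ
Δ-along a (inside  ∷ T) f = Δ-along (a ∘ suc) T (Δ (a zero) f)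
Δ-along a (outside ∷ T) f = Δ-along (a ∘ suc) T f

Δ-along-leading : ∀ {n k L f} (a : Fin n → ℤ) (T : Subset n) → card T ≡ k →
                  Leading k L f → Δ-along a T f ≡ L * + (k !) * subsetProduct a T
Δ-along-leading a [] refl (constant hf) = trans (hf 0ℤ) (unit _)
  where
  unit : ∀ L → L ≡ L * + 1 * 1ℤ
  unit = solve-∀
Δ-along-leading a (outside ∷ T) |T|≡k hf = Δ-along-leading (a ∘ suc) T |T|≡k hf
Δ-along-leading {L = L} {f} a (inside ∷ T) refl (differences hf) =
  begin
    Δ-along (a ∘ suc) T (Δ (a zero) f)
      ≡⟨ Δ-along-leading (a ∘ suc) T refl (hf (a zero)) ⟩
    + suc k * L * a zero * + (k !) * P
      ≡⟨ regroup (+ suc k) L (a zero) (+ (k !)) P ⟩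
    L * (+ suc k * + (k !)) * (a zero * P)
      ≡⟨ cong (λ t → L * t * (a zero * P)) (pos-* (suc k) (k !)) ⟨
    L * + (suc k !) * (a zero * P)
  ∎
  where
  open ≡-Reasoning
  k : ℕ
  k = card T
  P : ℤ
  P = subsetProduct (a ∘ suc) T
  regroup : ∀ k L a f P → k * L * a * f * P ≡ L * (k * f) * (a * P)
  regroup = solve-∀

product-cofactor : ∀ {n} (a : Fin n → ℤ) k → subsetProduct a ⊤ ≡ a k * subsetProduct a (∁ ⁅ k ⁆)
product-cofactor {suc n} a zero = cong (λ T → a zero * subsetProduct (a ∘ suc) T) (sym ∁⊥≡⊤)
  where
  ∁⊥≡⊤ : ∁ ⊥ ≡ ⊤ {n}
  ∁⊥≡⊤ = ∣p∣≡n⇒p≡⊤ (trans (∣∁p∣≡n∸∣p∣ (⊥ {n})) (cong (n ℕ.∸_) (∣⊥∣≡0 n)))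
product-cofactor a (suc k) =
  trans (cong (a zero *_) (product-cofactor (a ∘ suc) k)) (swap (a zero) (a (suc k)) _)
  where
  swap : ∀ x y z → x * (y * z) ≡ y * (x * z)
  swap = solve-∀

module Congruence (p : ℕ) where

  infix 4 _≈_
  record _≈_ (x y : ℤ) : Set where
    constructor congruent
    field difference : + p ∣ x - y

  ≈-by : ∀ {x y d} → x - y ≡ d → + p ∣ d → x ≈ y
  ≈-by x-y≡d p∣d = congruent (subst (+ p ∣_) (sym x-y≡d) p∣d)

  p∣0 : + p ∣ 0ℤ
  p∣0 = divides 0ℤ refl

  ≈-refl : ∀ {x} → x ≈ x
  ≈-refl {x} = ≈-by (+-inverseʳ x) p∣0

  ≈-reflexive : ∀ {x y} → x ≡ y → x ≈ y
  ≈-reflexive refl = ≈-refl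

  ≈-sym : ∀ {x y} → x ≈ y → y ≈ x
  ≈-sym {x} {y} (congruent h) = ≈-by (negate x y) (∣m⇒∣-m h)
    where
    negate : ∀ x y → y - x ≡ - (x - y)
    negate = solve-∀

  ≈-trans : ∀ {x y z} → x ≈ y → y ≈ z → x ≈ z
  ≈-trans {x} {y} {z} (congruent h) (congruent h′) = ≈-by (split x y z) (∣m∣n⇒∣m+n h h′)
    where
    split : ∀ x y z → x - z ≡ (x - y) + (y - z)
    split = solve-∀

  ≈-setoid : Setoid _ _
  ≈-setoid = record
    { Carrier       = ℤ
    ; _≈_           = _≈_
    ; isEquivalence = record { refl = ≈-refl ; sym = ≈-sym ; trans = ≈-trans }
    }

  ≈-+ : ∀ {a b c d} → a ≈ b → c ≈ d → a + c ≈ b + d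
  ≈-+ {a} {b} {c} {d} (congruent h) (congruent h′) = ≈-by (split a b c d) (∣m∣n⇒∣m+n h h′)
    where
    split : ∀ a b c d → (a + c) - (b + d) ≡ (a - b) + (c - d)
    split = solve-∀

  ≈-- : ∀ {a b c d} → a ≈ b → c ≈ d → a - c ≈ b - d
  ≈-- {a} {b} {c} {d} (congruent h) (congruent h′) = ≈-by (split a b c d) (∣m∣n⇒∣m-n h h′)
    where
    split : ∀ a b c d → (a - c) - (b - d) ≡ (a - b) - (c - d)
    split = solve-∀

  ≈-* : ∀ {a b c d} → a ≈ b → c ≈ d → a * c ≈ b * d
  ≈-* {a} {b} {c} {d} (congruent h) (congruent h′) =
    ≈-by (split a b c d) (∣m∣n⇒∣m+n (∣n⇒∣m*n a h′) (∣n⇒∣m*n d h))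
    where
    split : ∀ a b c d → a * c - b * d ≡ a * (c - d) + d * (a - b)
    split = solve-∀

  ≈-*ˡ : ∀ c {x y} → x ≈ y → c * x ≈ c * y
  ≈-*ˡ c = ≈-* (≈-refl {c})

  ≈-∣ : ∀ {x y} → x ≈ y → + p ∣ y → + p ∣ x
  ≈-∣ {x} {y} (congruent h) p∣y = subst (+ p ∣_) (cancel x y) (∣m∣n⇒∣m+n h p∣y)
    where
    cancel : ∀ x y → (x - y) + y ≡ x
    cancel = solve-∀

  ∣-≈ : ∀ {x y} → + p ∣ x → + p ∣ y → x ≈ y
  ∣-≈ p∣x p∣y = congruent (∣m∣n⇒∣m-n p∣x p∣y)

  falling-cong : ∀ n {x y} → x ≈ y → falling n x ≈ falling n y
  falling-cong zero    x≈y = ≈-refl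
  falling-cong (suc n) x≈y = ≈-* (≈-+ x≈y ≈-refl) (falling-cong n x≈y)

  -- An iterated difference only sees f through its values at subset sums,
  -- so it respects congruence of those values.
  Δ-along-cong : ∀ {n f g} (a b : Fin n → ℤ) (T : Subset n) →
                 (∀ x → f (subsetSum a x) ≈ g (subsetSum b x)) →
                 Δ-along a T f ≈ Δ-along b T g
  Δ-along-cong a b []            h = h []
  Δ-along-cong a b (outside ∷ T) h = Δ-along-cong (a ∘ suc) (b ∘ suc) T (λ x → h (outside ∷ x))
  Δ-along-cong a b (inside  ∷ T) h =
    Δ-along-cong (a ∘ suc) (b ∘ suc) T (λ x → ≈-- (h (inside ∷ x)) (h (outside ∷ x)))

  subsetSum-scale : ∀ {n} (a b : Fin n → ℤ) c → (∀ i → b i ≈ c * a i) →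
                    ∀ x → subsetSum b x ≈ c * subsetSum a x
  subsetSum-scale a b c b≈ca []            = ≈-reflexive (sym (*-zeroʳ c))
  subsetSum-scale a b c b≈ca (outside ∷ x) = subsetSum-scale (a ∘ suc) (b ∘ suc) c (b≈ca ∘ suc) x
  subsetSum-scale a b c b≈ca (inside  ∷ x) =
    ≈-trans (≈-+ (b≈ca zero) (subsetSum-scale (a ∘ suc) (b ∘ suc) c (b≈ca ∘ suc) x))
            (≈-reflexive (distrib c (a zero) (subsetSum (a ∘ suc) x)))
    where
    distrib : ∀ c a s → c * a + c * s ≡ c * (a + s)
    distrib = solve-∀

  SameZeros : ∀ {n} → (Fin n → ℤ) → (Fin n → ℤ) → Set
  SameZeros a b = ∀ x → (+ p ∣ subsetSum a x) ⇔ (+ p ∣ subsetSum b x)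

module ModPrime (m : ℕ) (prime : Prime (suc m)) where

  p : ℕ
  p = suc m

  open Congruence p

  -- Euclid's lemma for integers, transferred from ℕ through absolute values.
  euclid : ∀ x y → + p ∣ x * y → + p ∣ x ⊎ + p ∣ y
  euclid x y p∣xy =
    Sum.map ∣ᵤ⇒∣ ∣ᵤ⇒∣ (euclidsLemma ℤ.∣ x ∣ ℤ.∣ y ∣ prime (subst (p ∣ℕ_) (abs-* x y) (∣⇒∣ᵤ p∣xy)))

  ≈-cancel : ∀ {c x y} → ¬ (+ p ∣ c) → c * x ≈ c * y → x ≈ y
  ≈-cancel {c} {x} {y} p∤c (congruent h) =
    Sum.[ flip contradiction p∤c , congruent ]′ (euclid c (x - y) (subst (+ p ∣_) (factor c x y) h))
    where
    factor : ∀ c x y → c * x - c * y ≡ c * (x - y)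
    factor = solve-∀

  1<p : 1 ℕ.< p
  1<p = ℕ.nonTrivial⇒n>1 p {{prime⇒nonTrivial prime}}

  ∤-small : ∀ {n} → n ≢ 0 → n ℕ.< p → ¬ (+ p ∣ + n)
  ∤-small n≢0 n<p p∣n = >⇒∤ {{ℕ.≢-nonZero n≢0}} n<p (∣⇒∣ᵤ p∣n)

  ∤-factorial : ∀ j → j ℕ.< p → ¬ (+ p ∣ + (j !))
  ∤-factorial zero    _   = ∤-small (λ ()) 1<p
  ∤-factorial (suc j) j<p p∣j! with euclid (+ suc j) (+ (j !)) (subst (+ p ∣_) (pos-* (suc j) (j !)) p∣j!)
  ... | inj₁ p∣1+j = ∤-small (λ ()) j<p p∣1+j
  ... | inj₂ p∣j!  = ∤-factorial j (ℕ.<-trans (ℕ.n<1+n j) j<p) p∣j!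

  ∤-subsetProduct : ∀ {n} (a : Fin n → ℤ) T → (∀ i → ¬ (+ p ∣ a i)) → ¬ (+ p ∣ subsetProduct a T)
  ∤-subsetProduct a []            p∤a = ∤-small (λ ()) 1<p
  ∤-subsetProduct a (outside ∷ T) p∤a = ∤-subsetProduct (a ∘ suc) T (p∤a ∘ suc)
  ∤-subsetProduct a (inside  ∷ T) p∤a p∣aP =
    Sum.[ p∤a zero , ∤-subsetProduct (a ∘ suc) T (p∤a ∘ suc) ]′ (euclid _ _ p∣aP)

  ≈-residue : ∀ x → x ≈ + (x %ℕ p)
  ≈-residue x = ≈-by x-r≡qp (divides q refl)
    where
    r : ℕ
    r = x %ℕ p
    q : ℤ
    q = x /ℕ p
    cancel : ∀ r s → (r + s) - r ≡ s
    cancel = solve-∀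
    x-r≡qp : x - + r ≡ q * + p
    x-r≡qp = trans (cong (_- + r) (a≡a%ℕn+[a/ℕn]*n x p)) (cancel (+ r) (q * + p))

  -- … and distinct residues are incongruent, as their difference is smaller than p.
  residue-unique : ∀ {r s} → r ℕ.< p → s ℕ.< p → + r ≈ + s → r ≡ s
  residue-unique {r} {s} r<p s<p (congruent p∣r-s) =
    +-injective (i-j≡0⇒i≡j (+ r) (+ s) (∣i∣≡0⇒i≡0 (multiple<p⇒0 (∣⇒∣ᵤ p∣r-s) |r-s|<p)))
    where
    multiple<p⇒0 : ∀ {d} → p ∣ℕ d → d ℕ.< p → d ≡ 0
    multiple<p⇒0 {zero}  _   _   = refl
    multiple<p⇒0 {suc d} p∣d d<p = contradiction p∣d (>⇒∤ d<p)
    |r-s|<p : ℤ.∣ + r - + s ∣ ℕ.< p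
    |r-s|<p = ℕ.≤-<-trans (subst (ℕ._≤ r ℕ.⊔ s) (cong ℤ.∣_∣ (sym ([+m]-[+n]≡m⊖n r s))) (∣m⊝n∣≤m⊔n r s))
                          (ℕ.⊔-pres-<m r<p s<p)

  nonzero-residue : ∀ x → ¬ (+ p ∣ x) → ∃ λ r → x ≈ + suc r × suc r ℕ.< p
  nonzero-residue x p∤x with x %ℕ p | ≈-residue x | n%ℕd<d x p
  ... | zero  | x≈0 | _   = contradiction (≈-∣ x≈0 p∣0) p∤x
  ... | suc r | x≈r | r<p = r , x≈r , r<p

  bézout-inverse : ∀ {r} → suc r ℕ.< p → ∃ λ u → u * + suc r ≈ 1ℤ
  bézout-inverse {r} r<p with coprime-Bézout (prime⇒coprime prime r<p)
  ... | Bézout.+- a b 1+br≡ap = - + b , ≈-by lift-Bézout (∣m⇒∣-m (divides (+ a) refl))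
    where
    rearrange : ∀ b r → - b * r - 1ℤ ≡ - (1ℤ + b * r)
    rearrange = solve-∀
    lift-Bézout : - + b * + suc r - 1ℤ ≡ - (+ a * + p)
    lift-Bézout = begin
      - + b * + suc r - 1ℤ      ≡⟨ rearrange (+ b) (+ suc r) ⟩
      - (1ℤ + + b * + suc r)    ≡⟨ cong (λ t → - (1ℤ + t)) (pos-* b (suc r)) ⟨
      - + (1 ℕ.+ b ℕ.* suc r)   ≡⟨ cong (-_ ∘ +_) 1+br≡ap ⟩
      - + (a ℕ.* p)             ≡⟨ cong -_ (pos-* a p) ⟩
      - (+ a * + p)             ∎
      where open ≡-Reasoning
  ... | Bézout.-+ a b 1+ap≡br = + b , ≈-by lift-Bézout (divides (+ a) refl)
    where
    rearrange : ∀ a p → (1ℤ + a * p) - 1ℤ ≡ a * p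
    rearrange = solve-∀
    lift-Bézout : + b * + suc r - 1ℤ ≡ + a * + p
    lift-Bézout = begin
      + b * + suc r - 1ℤ        ≡⟨ cong (_- 1ℤ) (pos-* b (suc r)) ⟨
      + (b ℕ.* suc r) - 1ℤ      ≡⟨ cong (λ t → + t - 1ℤ) 1+ap≡br ⟨
      + (1 ℕ.+ a ℕ.* p) - 1ℤ    ≡⟨ cong (λ t → (1ℤ + t) - 1ℤ) (pos-* a p) ⟩
      (1ℤ + + a * + p) - 1ℤ     ≡⟨ rearrange (+ a) (+ p) ⟩
      + a * + p                 ∎
      where open ≡-Reasoning

  inverse : ∀ x → ¬ (+ p ∣ x) → ∃ λ u → u * x ≈ 1ℤ
  inverse x p∤x with nonzero-residue x p∤x
  ... | r , x≈r , r<p with bézout-inverse r<p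
  ...   | u , ur≈1 = u , ≈-trans (≈-*ˡ u x≈r) ur≈1

  -- The falling product of degree p - 1 vanishes modulo p off the multiples
  -- of p, since every non-multiple is congruent to one of its roots 1, …, p - 1.
  falling-vanishes : ∀ y → ¬ (+ p ∣ y) → + p ∣ falling m y
  falling-vanishes y p∤y with nonzero-residue y p∤y
  ... | r , y≈r , r<p =
    ≈-∣ (falling-cong m y≈r) (subst (+ p ∣_) (sym (falling-root m (ℕ.s≤s ℕ.z≤n) (ℕ.≤-pred r<p))) p∣0)

  falling-zeroPattern : ∀ {x y} → (+ p ∣ x) ⇔ (+ p ∣ y) → falling m x ≈ falling m y
  falling-zeroPattern {x} {y} x⇔y with + p ∣? x
  ... | yes p∣x = falling-cong m (∣-≈ p∣x (to x⇔y p∣x))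
  ... | no  p∤x = ∣-≈ (falling-vanishes x p∤x) (falling-vanishes y (p∤x ∘ from x⇔y))

  -- Differencing falling m, a monic polynomial of
  -- degree m = p - 1, along the m directions other than k produces
  -- m! · ∏_{i ≠ k} a i; this only depends on which subset sums of a are
  -- divisible by p, and m! is invertible modulo p.
  cofactors-agree : (a b : Fin p → ℤ) → SameZeros a b → ∀ k →
                    subsetProduct a (∁ ⁅ k ⁆) ≈ subsetProduct b (∁ ⁅ k ⁆)
  cofactors-agree a b same k = ≈-cancel (∤-factorial m (ℕ.n<1+n m)) (begin
    + (m !) * subsetProduct a T         ≡⟨ cong (_* subsetProduct a T) (*-identityˡ (+ (m !))) ⟨
    1ℤ * + (m !) * subsetProduct a T    ≡⟨ Δ-along-leading a T card[T]≡m (falling-leading m) ⟨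
    Δ-along a T (falling m)             ≈⟨ Δ-along-cong a b T (λ x → falling-zeroPattern (same x)) ⟩
    Δ-along b T (falling m)             ≡⟨ Δ-along-leading b T card[T]≡m (falling-leading m) ⟩
    1ℤ * + (m !) * subsetProduct b T    ≡⟨ cong (_* subsetProduct b T) (*-identityˡ (+ (m !))) ⟩
    + (m !) * subsetProduct b T         ∎)
    where
    open ≈-Reasoning ≈-setoid
    T : Subset p
    T = ∁ ⁅ k ⁆
    card[T]≡m : card T ≡ m
    card[T]≡m = trans (∣∁p∣≡n∸∣p∣ ⁅ k ⁆) (cong (p ℕ.∸_) (∣⁅x⁆∣≡1 k))

  -- If every a i is a unit modulo p, SameZeros forces b to be a multiple of a:
  -- the cofactor identity gives  ∏ a · b k ≈ ∏ b · a k,  and ∏ a is invertible.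
  proportional : (a b : Fin p → ℤ) → (∀ i → ¬ (+ p ∣ a i)) → SameZeros a b →
                 ∃ λ μ → ∀ k → b k ≈ μ * a k
  proportional a b p∤a same = u * Pb , λ k → ≈-cancel p∤Pa (begin
    Pa * b k                  ≈⟨ cross k ⟩
    Pb * a k                  ≡⟨ *-identityˡ (Pb * a k) ⟨
    1ℤ * (Pb * a k)           ≈⟨ ≈-* (≈-sym u*Pa≈1) ≈-refl ⟩
    u * Pa * (Pb * a k)       ≡⟨ regroup u Pa Pb (a k) ⟩
    Pa * (u * Pb * a k)       ∎)
    where
    open ≈-Reasoning ≈-setoid
    Pa Pb : ℤ
    Pa = subsetProduct a ⊤
    Pb = subsetProduct b ⊤
    p∤Pa : ¬ (+ p ∣ Pa)
    p∤Pa = ∤-subsetProduct a ⊤ p∤a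
    u : ℤ
    u = proj₁ (inverse Pa p∤Pa)
    u*Pa≈1 : u * Pa ≈ 1ℤ
    u*Pa≈1 = proj₂ (inverse Pa p∤Pa)
    regroup : ∀ u P Q a → u * P * (Q * a) ≡ P * (u * Q * a)
    regroup = solve-∀
    cross : ∀ k → Pa * b k ≈ Pb * a k
    cross k = begin
      Pa * b k                                 ≡⟨ cong (_* b k) (product-cofactor a k) ⟩
      a k * subsetProduct a (∁ ⁅ k ⁆) * b k    ≡⟨ swap (a k) _ (b k) ⟩
      a k * b k * subsetProduct a (∁ ⁅ k ⁆)    ≈⟨ ≈-*ˡ (a k * b k) (cofactors-agree a b same k) ⟩
      a k * b k * subsetProduct b (∁ ⁅ k ⁆)    ≡⟨ swap′ (a k) (b k) _ ⟩
      b k * subsetProduct b (∁ ⁅ k ⁆) * a k    ≡⟨ cong (_* a k) (product-cofactor b k) ⟨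
      Pb * a k                                 ∎
      where
      swap : ∀ x y z → x * y * z ≡ x * z * y
      swap = solve-∀
      swap′ : ∀ x y z → x * y * z ≡ y * z * x
      swap′ = solve-∀

  proportional⇒sameZeros : ∀ {n} (a b : Fin n → ℤ) μ → ¬ (+ p ∣ μ) →
                           (∀ k → b k ≈ μ * a k) → SameZeros a b
  proportional⇒sameZeros a b μ p∤μ b≈μa x = mk⇔
    (λ p∣Sa → ≈-∣ Sb≈μSa (∣n⇒∣m*n μ p∣Sa))
    (λ p∣Sb → Sum.[ flip contradiction p∤μ , id ]′ (euclid μ _ (≈-∣ (≈-sym Sb≈μSa) p∣Sb)))
    where
    Sb≈μSa : subsetSum b x ≈ μ * subsetSum a x
    Sb≈μSa = subsetSum-scale a b μ b≈μa x

  lift : ∀ {ℓ} → (Fin ℓ → Fin p) → Fin ℓ → ℤ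
  lift c i = + toℕ (c i)

  lift-∤ : ∀ {ℓ} (c : Fin ℓ → Fin p) → (∀ i → toℕ (c i) ≢ 0) → ∀ i → ¬ (+ p ∣ lift c i)
  lift-∤ c c≢0 i = ∤-small (c≢0 i) (toℕ<n (c i))

  InS⇔ : ∀ {ℓ} (c : Fin ℓ → Fin p) x → InS p c x ⇔ (+ p ∣ subsetSum (lift c) (tabulate x))
  InS⇔ c x = mk⇔
    (λ p∣S → subst (+ p ∣_) (linearForm (toℕ ∘ c) x) (∣ᵤ⇒∣ p∣S))
    (λ p∣S → ∣⇒∣ᵤ (subst (+ p ∣_) (sym (linearForm (toℕ ∘ c) x)) p∣S))

  sameS⇒sameZeros : ∀ {ℓ} (a b : Fin ℓ → Fin p) → SameS p a b → SameZeros (lift a) (lift b)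
  sameS⇒sameZeros a b S x =
    subst (λ v → (+ p ∣ subsetSum (lift a) v) ⇔ (+ p ∣ subsetSum (lift b) v)) (tabulate∘lookup x)
      (mk⇔ (to (InS⇔ b (lookup x)) ∘ proj₁ (S (lookup x)) ∘ from (InS⇔ a (lookup x)))
           (to (InS⇔ a (lookup x)) ∘ proj₂ (S (lookup x)) ∘ from (InS⇔ b (lookup x))))

  sameZeros⇒sameS : ∀ {ℓ} (a b : Fin ℓ → Fin p) → SameZeros (lift a) (lift b) → SameS p a b
  sameZeros⇒sameS a b Z x =
    from (InS⇔ b x) ∘ to (Z (tabulate x)) ∘ to (InS⇔ a x) ,
    from (InS⇔ a x) ∘ from (Z (tabulate x)) ∘ to (InS⇔ b x)

  scale⇒proportional : ∀ {ℓ} (a b : Fin ℓ → Fin p) μ → (∀ k → b k ≡ scale p prime μ a k) →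
                       ∀ k → lift b k ≈ + toℕ μ * lift a k
  scale⇒proportional a b μ b≡μa k = begin
    + toℕ (b k)                       ≡⟨ cong (+_ ∘ toℕ) (b≡μa k) ⟩
    + toℕ (scale p prime μ a k)       ≡⟨ cong +_ (toℕ-fromℕ< _) ⟩
    + ((toℕ μ ℕ.* toℕ (a k)) ℕ.% p)   ≈⟨ ≈-residue (+ (toℕ μ ℕ.* toℕ (a k))) ⟨
    + (toℕ μ ℕ.* toℕ (a k))           ≡⟨ pos-* (toℕ μ) (toℕ (a k)) ⟩
    + toℕ μ * lift a k                ∎
    where open ≈-Reasoning ≈-setoid

  proportional⇒scale : ∀ {ℓ} (a b : Fin ℓ → Fin p) → (∃ λ ν → ∀ k → lift b k ≈ ν * lift a k) →
                       ∃ λ μ → ∀ k → b k ≡ scale p prime μ a k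
  proportional⇒scale a b (ν , b≈νa) = μ , λ k →
    toℕ-injective (trans (residue-unique (toℕ<n (b k)) (m%n<n (toℕ μ ℕ.* toℕ (a k)) p) (b≈μa k))
                         (sym (toℕ-fromℕ< _)))
    where
    open ≈-Reasoning ≈-setoid
    μ : Fin p
    μ = fromℕ< (n%ℕd<d ν p)
    b≈μa : ∀ k → lift b k ≈ + ((toℕ μ ℕ.* toℕ (a k)) ℕ.% p)
    b≈μa k = begin
      lift b k                          ≈⟨ b≈νa k ⟩
      ν * lift a k                      ≈⟨ ≈-* (≈-residue ν) ≈-refl ⟩
      + (ν %ℕ p) * lift a k             ≡⟨ cong (λ t → + t * lift a k) (toℕ-fromℕ< (n%ℕd<d ν p)) ⟨
      + toℕ μ * lift a k                ≡⟨ pos-* (toℕ μ) (toℕ (a k)) ⟨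
      + (toℕ μ ℕ.* toℕ (a k))           ≈⟨ ≈-residue (+ (toℕ μ ℕ.* toℕ (a k))) ⟩
      + ((toℕ μ ℕ.* toℕ (a k)) ℕ.% p)   ∎

  scale⇒sameS : ∀ {ℓ} (a b : Fin (suc ℓ) → Fin p) μ → (∀ k → b k ≡ scale p prime μ a k) →
                (∀ i → toℕ (b i) ≢ 0) → SameS p a b
  scale⇒sameS a b μ b≡μa b≢0 =
    sameZeros⇒sameS a b (proportional⇒sameZeros (lift a) (lift b) (+ toℕ μ) p∤μ b≈μa)
    where
    b≈μa : ∀ k → lift b k ≈ + toℕ μ * lift a k
    b≈μa = scale⇒proportional a b μ b≡μa
    p∤μ : ¬ (+ p ∣ + toℕ μ)
    p∤μ p∣μ = lift-∤ b b≢0 zero (≈-∣ (b≈μa zero) (∣m⇒∣m*n (lift a zero) p∣μ))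

corollary1p5 : (p : ℕ) (pr : Prime p) (A B : Fin p → Fin p) →
    (∀ i → toℕ (A i) ≢ 0) → (∀ i → toℕ (B i) ≢ 0) →
    (SameS p A B → Collinear p pr A B) × (Collinear p pr A B → SameS p A B)
corollary1p5 zero    pr = contradiction pr ¬prime[0]
corollary1p5 (suc m) pr A B A≢0 B≢0 = sameS⇒collinear , collinear⇒sameS
  where
  open ModPrime m pr
  sameS⇒collinear : SameS (suc m) A B → Collinear (suc m) pr A B
  sameS⇒collinear S =
    inj₁ (proportional⇒scale A B (proportional (lift A) (lift B) (lift-∤ A A≢0) (sameS⇒sameZeros A B S)))
  collinear⇒sameS : Collinear (suc m) pr A B → SameS (suc m) A B
  collinear⇒sameS (inj₁ (μ , B≡μA)) = scale⇒sameS A B μ B≡μA B≢0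
  collinear⇒sameS (inj₂ (μ , A≡μB)) = Product.swap ∘ scale⇒sameS B A μ A≡μB A≢0
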